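{- Let $n=4k$ with $k\ge1$ an integer, and consider the schedule in which the game between teams $i<j$ is played in round $S(i,j)$ (table defined below), with team $j$ at home if $i$ and $j$ have the same parity and team $i$ at home if they have different parity. Then this schedule is single-break: every team's HAP has exactly one break.
   Context: Teams are $1,\dots,n$, rounds are $1,\dots,n-1$. For integers $a$ and $m\ge1$, $a \bmod m$ denotes the residue in $\{0,\dots,m-1\}$. Define $\pi_i(j)=1+((n+1-i-j)\bmod (n-1))$. The table $S(i,j)$ for $i<j$ is: (1) for odd $i\le n/2$: $S(i,j)=\pi_i(j)$ for $i<j<n$, and $S(i,n)=\pi_i(i)$; (2) for odd $i$ with $n/2<i\le n-3$: $S(i,j)=\pi_i(j)$ for $i+1<j<n$, $S(i,i+1)=\pi_i(i)$, $S(i,n)=\pi_i(i+1)$; (3) $S(n-1,n)=3$; (4) for even $i$ and $j>i$: $S(i,j)=S(i-1,j+1)$ if $j$ is odd and $S(i,j)=S(i-1,j-1)$ if $j$ is even; and $S(j,i):=S(i,j)$. The HAP of a team is $(h_1,\dots,h_{n-1})$ with $h_r\in\{H,A\}$ its venue in round $r$, read cyclically with $h_0:=h_{n-1}$; a team has a break in round $r$ if $h_{r-1}=h_r$. -}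

module Defs where

open import Data.Nat using (ℕ; zero; suc; _+_; _*_; _∸_; _≤ᵇ_; _<ᵇ_; _≡ᵇ_)
open import Data.Integer using (ℤ; +_; _-_)
open import Data.Integer.DivMod using (_%ℕ_)
open import Data.Bool using (Bool; true; false; if_then_else_; _∧_; _∨_; not)
open import Data.List using (List; []; _∷_; length; map)
open import Data.Bool.ListAction using (any)
open import Data.List.Base using (upTo)
open import Relation.Binary.PropositionalEquality using (_≡_)
open import Relation.Nullary.Decidable using (Dec; yes; no)

oddB : ℕ → Bool
oddB zero = false
oddB (suc zero) = true
oddB (suc (suc m)) = oddB m

-- π_i(j) = 1 + ((n + 1 - i - j) mod (n - 1)), computed in ℤ.
-- Only meaningful for n ≥ 2 (divisor n - 1 ≥ 1); returns 0 otherwise.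
π : (n i j : ℕ) → ℕ
π (suc (suc m)) i j = suc (((+ (suc (suc m) + 1) - + i) - + j) %ℕ (suc m))
π _ i j = 0

-- S(i,j) for odd i < j (clauses (1),(2),(3) of the table)
Sodd : (n i j : ℕ) → ℕ
Sodd n i j =
  if i ≡ᵇ (n ∸ 1) then 3                          -- (3): i = n-1, j = n
  else if (2 * i) ≤ᵇ n
    then (if j <ᵇ n then π n i j else π n i i)
  else                                             -- (2): n/2 < i ≤ n-3
    (if j ≡ᵇ (i + 1) then π n i i
     else if j ≡ᵇ n then π n i (i + 1)
     else π n i j)

-- S(i,j) for i < j (clause (4) for even i)
S : (n i j : ℕ) → ℕ
S n i j =
  if oddB i then Sodd n i j
  else (if oddB j then Sodd n (i ∸ 1) (j + 1) else Sodd n (i ∸ 1) (j ∸ 1))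

round : (n t u : ℕ) → ℕ
round n t u = if t <ᵇ u then S n t u else S n u t

sameParity : ℕ → ℕ → Bool
sameParity a b = if oddB a then oddB b else not (oddB b)

homeAgainst : (t u : ℕ) → Bool
homeAgainst t u = if u <ᵇ t then sameParity t u else not (sameParity t u)

data Venue : Set where
  H A : Venue

_=V_ : Venue → Venue → Bool
H =V H = true
A =V A = true
_ =V _ = false

teams : ℕ → List ℕ
teams n = map suc (upTo n)

venue : (n t r : ℕ) → Venue
venue n t r =
  if any (λ u → not (u ≡ᵇ t) ∧ (round n t u ≡ᵇ r) ∧ homeAgainst t u) (teams n)
  then H else A

-- HAP read cyclically: h_0 := h_{n-1}
hap : (n t r : ℕ) → Venue
hap n t zero = venue n t (n ∸ 1)
hap n t (suc r) = venue n t (suc r)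

countB : (ℕ → Bool) → List ℕ → ℕ
countB p [] = 0
countB p (x ∷ xs) = if p x then suc (countB p xs) else countB p xs

breaks : (n t : ℕ) → ℕ
breaks n t = countB (λ r → hap n t (r ∸ 1) =V hap n t r)
                    (map suc (upTo (n ∸ 1)))

{-# OPTIONS --safe #-}
-- Write team 2a + 1 + [e] as team a e: pair a ≤ K = n/2 - 1, bit e. Seen from team (a, e), every
-- opponent sits at an offset δ < n - 1, the game being played in round 1 + ((c_a - δ) mod (n - 1))
-- for a constant c_a, and at home iff δ is even, except that the pattern shifts parity once: past
-- the offset θ = breakOffset a e, home games are those at odd δ. Offsets and rounds are in bijection,
-- and rounds r - 1 and r correspond to offsets δ + 1 and δ (mod n - 1). Since n - 1 is odd, the
-- venue sequence read cyclically therefore repeats exactly once, in the round of offset θ.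
module Submission where

open import Defs
open import Data.Nat using (ℕ; _*_; _≤_)
open import Relation.Binary.PropositionalEquality using (_≡_)

open import Data.Bool using (Bool; true; false; not; if_then_else_; _∧_; _∨_; _xor_)
open import Data.Bool.Properties using (∨-zeroʳ; not-involutive; xor-same; xor-inverseˡ; xor-inverseʳ; xor-comm)
open import Data.Bool.ListAction using (any)
open import Data.Integer using (-[1+_]; _⊖_)
import Data.Integer as ℤ
open import Data.Integer.DivMod using (_%ℕ_)
import Data.Integer.Properties as ℤₚ
open import Data.List using ([]; _∷_)
open import Data.List.Membership.Propositional using (_∈_)
open import Data.List.Membership.Propositional.Properties using (∈-map⁺; ∈-map⁻; ∈-upTo⁺; ∈-upTo⁻)
open import Data.List.Relation.Unary.All as All using (All; []; _∷_)
open import Data.List.Relation.Unary.Any using (here; there)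
open import Data.List.Relation.Unary.Unique.Propositional using (Unique; _∷_)
import Data.List.Relation.Unary.Unique.Propositional.Properties as Unique
open import Data.Nat using (zero; suc; pred; _+_; _∸_; _<_; _≤ᵇ_; _<ᵇ_; _≡ᵇ_; s≤s; z≤n; z<s; NonZero; _≟_; _≤?_; _<?_)
open import Data.Nat.Properties
open import Data.Nat.DivMod using (_%_; _/_; m≡m%n+[m/n]*n; [m+n]%n≡m%n; [m+kn]%n≡m%n; m<n⇒m%n≡m; m%n<n; n%n≡0; %-distribˡ-+; m%n%n≡m%n)
open import Data.Nat.Tactic.RingSolver using (solve-∀)
open import Data.Product using (∃; ∃₂; _×_; _,_)
open import Data.Sum using (_⊎_; inj₁; inj₂)
open import Function using (_∘_)
open import Relation.Binary.Definitions using (tri<; tri≈; tri>)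
open import Relation.Binary.PropositionalEquality using (_≢_; refl; sym; trans; cong; cong₂; subst; ≢-sym; module ≡-Reasoning)
open import Relation.Nullary.Decidable using (yes; no; dec-true; dec-false)
open import Relation.Nullary.Negation using (contradiction)

if-true : ∀ {A : Set} {b} {x y : A} → b ≡ true → (if b then x else y) ≡ x
if-true refl = refl

if-false : ∀ {A : Set} {b} {x y : A} → b ≡ false → (if b then x else y) ≡ y
if-false refl = refl

≤ᵇ-true : ∀ {m n} → m ≤ n → (m ≤ᵇ n) ≡ true
≤ᵇ-true = dec-true (_ ≤? _)

≤ᵇ-false : ∀ {m n} → n < m → (m ≤ᵇ n) ≡ false
≤ᵇ-false = dec-false (_ ≤? _) ∘ <⇒≱

<ᵇ-true : ∀ {m n} → m < n → (m <ᵇ n) ≡ true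
<ᵇ-true = dec-true (_ <? _)

<ᵇ-false : ∀ {m n} → n ≤ m → (m <ᵇ n) ≡ false
<ᵇ-false = dec-false (_ <? _) ∘ ≤⇒≯

≡ᵇ-refl : ∀ m → (m ≡ᵇ m) ≡ true
≡ᵇ-refl m = dec-true (m ≟ m) refl

≡ᵇ-true : ∀ {m n} → m ≡ n → (m ≡ᵇ n) ≡ true
≡ᵇ-true = dec-true (_ ≟ _)

≡ᵇ-false : ∀ {m n} → m ≢ n → (m ≡ᵇ n) ≡ false
≡ᵇ-false = dec-false (_ ≟ _)

xor-cancelˡ : ∀ e g → e xor (e xor g) ≡ g
xor-cancelˡ false g = refl
xor-cancelˡ true g = not-involutive g

≡⊎≡not : ∀ e f → f ≡ e ⊎ f ≡ not e
≡⊎≡not false false = inj₁ refl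
≡⊎≡not false true = inj₂ refl
≡⊎≡not true false = inj₂ refl
≡⊎≡not true true = inj₁ refl

xor≡true⇒≡not : ∀ e f → e xor f ≡ true → f ≡ not e
xor≡true⇒≡not false true refl = refl
xor≡true⇒≡not true false refl = refl

oddB-suc : ∀ m → oddB (suc m) ≡ not (oddB m)
oddB-suc zero = refl
oddB-suc (suc zero) = refl
oddB-suc (suc (suc m)) = oddB-suc m

oddB-double : ∀ m → oddB (m + m) ≡ false
oddB-double zero = refl
oddB-double (suc m) rewrite +-suc m m = oddB-double m

double+ : ℕ → Bool → ℕ
double+ m false = m + m
double+ m true = suc (m + m)

oddB-double+ : ∀ m g → oddB (double+ m g) ≡ g
oddB-double+ m false = oddB-double m
oddB-double+ m true = trans (oddB-suc (m + m)) (cong not (oddB-double m))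

double+-surjective : ∀ d → ∃₂ λ m g → d ≡ double+ m g
double+-surjective zero = 0 , false , refl
double+-surjective (suc d) with double+-surjective d
... | m , false , refl = m , true , refl
... | m , true , refl = suc m , false , cong suc (sym (+-suc m m))

double+-≤ : ∀ m g → double+ m g ≤ suc (m + m)
double+-≤ m false = n≤1+n (m + m)
double+-≤ m true = ≤-refl

double+-≥ : ∀ m g → m + m ≤ double+ m g
double+-≥ m false = ≤-refl
double+-≥ m true = n≤1+n (m + m)

double-< : ∀ {m n} → m < n → suc (suc (m + m)) ≤ n + n
double-< {m} {n} m<n = subst (_≤ n + n) (cong suc (+-suc m m)) (+-mono-≤ m<n m<n)

double-cancel-≤ : ∀ {m n} → m + m ≤ n + n → m ≤ n
double-cancel-≤ {m} {n} mm≤nn with m ≤? n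
... | yes m≤n = m≤n
... | no m≰n = contradiction mm≤nn (<⇒≱ (+-mono-< (≰⇒> m≰n) (≰⇒> m≰n)))

double-cancel-< : ∀ {m n} → m + m < n + n → m < n
double-cancel-< {m} {n} mm<nn with m <? n
... | yes m<n = m<n
... | no m≮n = contradiction mm<nn (≤⇒≯ (+-mono-≤ (≮⇒≥ m≮n) (≮⇒≥ m≮n)))

any-true : ∀ {A : Set} (p : A → Bool) {x xs} → x ∈ xs → p x ≡ true → any p xs ≡ true
any-true p {xs = _ ∷ xs} (here refl) px = cong (_∨ any p xs) px
any-true p {xs = y ∷ _} (there x∈xs) px = trans (cong (p y ∨_) (any-true p x∈xs px)) (∨-zeroʳ (p y))

any-false : ∀ {A : Set} (p : A → Bool) xs → (∀ {x} → x ∈ xs → p x ≡ false) → any p xs ≡ false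
any-false p [] _ = refl
any-false p (x ∷ xs) p≡false = cong₂ _∨_ (p≡false (here refl)) (any-false p xs (p≡false ∘ there))

countB-cong : ∀ {p q : ℕ → Bool} xs → (∀ {x} → x ∈ xs → p x ≡ q x) → countB p xs ≡ countB q xs
countB-cong [] _ = refl
countB-cong (x ∷ xs) p≡q =
  cong₂ (λ b c → if b then suc c else c) (p≡q (here refl)) (countB-cong xs (p≡q ∘ there))

countB-≡ᵇ-∉ : ∀ {x xs} → All (_≢ x) xs → countB (_≡ᵇ x) xs ≡ 0
countB-≡ᵇ-∉ [] = refl
countB-≡ᵇ-∉ (y≢x ∷ xs≢x) = trans (if-false (≡ᵇ-false y≢x)) (countB-≡ᵇ-∉ xs≢x)

countB-≡ᵇ-unique : ∀ {x xs} → Unique xs → x ∈ xs → countB (_≡ᵇ x) xs ≡ 1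
countB-≡ᵇ-unique {x} (x≢xs ∷ _) (here refl) =
  trans (if-true (≡ᵇ-refl x)) (cong suc (countB-≡ᵇ-∉ (All.map ≢-sym x≢xs)))
countB-≡ᵇ-unique (y≢xs ∷ xs!) (there x∈xs) =
  trans (if-false (≡ᵇ-false (All.lookup y≢xs x∈xs))) (countB-≡ᵇ-unique xs! x∈xs)

∈-teams⁺ : ∀ {m u} → u < m → suc u ∈ teams m
∈-teams⁺ = ∈-map⁺ suc ∘ ∈-upTo⁺

∈-teams⁻ : ∀ {m x} → x ∈ teams m → ∃ λ u → x ≡ suc u × u < m
∈-teams⁻ x∈ with ∈-map⁻ suc x∈
... | u , u∈ , refl = u , refl , ∈-upTo⁻ u∈

teams-unique : ∀ m → Unique (teams m)
teams-unique m = Unique.map⁺ suc-injective (Unique.upTo⁺ m)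

-[1+]-%ℕ : ∀ {m d} .{{_ : NonZero d}} → suc m < d → -[1+ m ] %ℕ d ≡ d ∸ suc m
-[1+]-%ℕ {m} {d} 1+m<d with suc m % d | m<n⇒m%n≡m 1+m<d
... | .(suc m) | refl = refl

⊖-%ℕ : ∀ a x d .{{_ : NonZero d}} → x < a + d → (a ⊖ x) %ℕ d ≡ (a + d ∸ x) % d
⊖-%ℕ a x d x<a+d with x ≤? a
... | yes x≤a = begin
  (a ⊖ x) %ℕ d     ≡⟨ cong (_%ℕ d) (ℤₚ.⊖-≥ x≤a) ⟩
  (a ∸ x) % d      ≡⟨ [m+n]%n≡m%n (a ∸ x) d ⟨
  (a ∸ x + d) % d  ≡⟨ cong (_% d) (+-∸-comm d x≤a) ⟨
  (a + d ∸ x) % d  ∎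
  where open ≡-Reasoning
... | no x≰a with m , refl ← m≤n⇒∃[o]m+o≡n (≰⇒> x≰a) = begin
  (a ⊖ (suc a + m)) %ℕ d     ≡⟨ cong (_%ℕ d) a⊖[1+a+m]≡-[1+m] ⟩
  -[1+ m ] %ℕ d              ≡⟨ -[1+]-%ℕ 1+m<d ⟩
  d ∸ suc m                  ≡⟨ m<n⇒m%n≡m (∸-monoʳ-< z<s (<⇒≤ 1+m<d)) ⟨
  (d ∸ suc m) % d            ≡⟨ cong (_% d) ([m+n]∸[m+o]≡n∸o a d (suc m)) ⟨
  (a + d ∸ (a + suc m)) % d  ≡⟨ cong (λ x → (a + d ∸ x) % d) (+-suc a m) ⟩
  (a + d ∸ (suc a + m)) % d  ∎
  where
  open ≡-Reasoning
  a⊖[1+a+m]≡-[1+m] : a ⊖ (suc a + m) ≡ -[1+ m ]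
  a⊖[1+a+m]≡-[1+m] = trans (cong₂ _⊖_ (sym (+-identityʳ a)) (sym (+-suc a m))) (ℤₚ.+-cancelˡ-⊖ a 0 (suc m))
  1+m<d : suc m < d
  1+m<d = +-cancelˡ-< a (suc m) d (subst (_< a + d) (sym (+-suc a m)) x<a+d)

[a-i]-j≡a⊖[i+j] : ∀ a i j → (ℤ.+ a ℤ.- ℤ.+ i) ℤ.- ℤ.+ j ≡ a ⊖ (i + j)
[a-i]-j≡a⊖[i+j] a i j = begin
  (ℤ.+ a ℤ.- ℤ.+ i) ℤ.- ℤ.+ j              ≡⟨ ℤₚ.+-assoc (ℤ.+ a) (ℤ.- ℤ.+ i) (ℤ.- ℤ.+ j) ⟩
  ℤ.+ a ℤ.+ (ℤ.- ℤ.+ i ℤ.+ ℤ.- ℤ.+ j)      ≡⟨ cong (λ k → ℤ.+ a ℤ.+ k) (ℤₚ.neg-distrib-+ (ℤ.+ i) (ℤ.+ j)) ⟨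
  ℤ.+ a ℤ.- (ℤ.+ i ℤ.+ ℤ.+ j)              ≡⟨ cong (λ k → ℤ.+ a ℤ.- k) (ℤₚ.pos-+ i j) ⟨
  ℤ.+ a ℤ.- ℤ.+ (i + j)                    ≡⟨ ℤₚ.m-n≡m⊖n a (i + j) ⟩
  a ⊖ (i + j)                              ∎
  where open ≡-Reasoning

module Reflection (N T : ℕ) .{{_ : NonZero N}} where

  reflect : ℕ → ℕ
  reflect x = (T ∸ x) % N

  suc-% : ∀ w → suc w % N ≡ suc (w % N) % N
  suc-% w = begin
    (1 + w) % N              ≡⟨ %-distribˡ-+ 1 w N ⟩
    (1 % N + w % N) % N      ≡⟨ cong (λ r → (1 % N + r) % N) (m%n%n≡m%n w N) ⟨
    (1 % N + w % N % N) % N  ≡⟨ %-distribˡ-+ 1 (w % N) N ⟨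
    (1 + w % N) % N          ∎
    where open ≡-Reasoning

  reflect-involutive : ∀ a b → a + b ≤ T → reflect (a + reflect (a + b)) ≡ b % N
  reflect-involutive a b a+b≤T = begin
    (T ∸ (a + w % N)) % N                              ≡⟨ cong (λ t → (t ∸ (a + w % N)) % N) T≡ ⟩
    (a + w % N + (b + w / N * N) ∸ (a + w % N)) % N  ≡⟨ cong (_% N) (m+n∸m≡n (a + w % N) _) ⟩
    (b + w / N * N) % N                                ≡⟨ [m+kn]%n≡m%n b (w / N) N ⟩
    b % N                                              ∎
    where
    open ≡-Reasoning
    w = T ∸ (a + b)
    regroup : ∀ a b r q → a + b + (r + q) ≡ a + r + (b + q)
    regroup = solve-∀
    T≡ : T ≡ a + w % N + (b + w / N * N)
    T≡ = begin
      T                            ≡⟨ m+[n∸m]≡n a+b≤T ⟨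
      a + b + w                    ≡⟨ cong (a + b +_) (m≡m%n+[m/n]*n w N) ⟩
      a + b + (w % N + w / N * N)  ≡⟨ regroup a b (w % N) (w / N * N) ⟩
      a + w % N + (b + w / N * N)  ∎

  reflect-suc : ∀ x → suc x ≤ T → reflect x ≡ suc (reflect (suc x)) % N
  reflect-suc x 1+x≤T = trans (cong (_% N) (+-∸-assoc 1 1+x≤T)) (suc-% (T ∸ suc x))

  reflect-+N : ∀ x → x + N ≤ T → reflect (x + N) ≡ reflect x
  reflect-+N x x+N≤T = trans (sym ([m+n]%n≡m%n (T ∸ (x + N)) N)) (sym (cong (_% N) T∸x≡))
    where
    open ≡-Reasoning
    w = T ∸ (x + N)
    T∸x≡ : T ∸ x ≡ w + N
    T∸x≡ = begin
      T ∸ x            ≡⟨ cong (_∸ x) (m+[n∸m]≡n x+N≤T) ⟨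
      x + N + w ∸ x    ≡⟨ cong (_∸ x) (+-assoc x N w) ⟩
      x + (N + w) ∸ x  ≡⟨ m+n∸m≡n x (N + w) ⟩
      N + w            ≡⟨ +-comm N w ⟩
      w + N            ∎

homeAt : ℕ → ℕ → Bool
homeAt θ δ = if δ ≤ᵇ θ then not (oddB δ) else oddB δ

homeAt-≤ : ∀ {θ δ} → δ ≤ θ → homeAt θ δ ≡ not (oddB δ)
homeAt-≤ = if-true ∘ ≤ᵇ-true

homeAt-> : ∀ {θ δ} → θ < δ → homeAt θ δ ≡ oddB δ
homeAt-> = if-false ∘ ≤ᵇ-false

homeAt-suc-xor : ∀ θ d → homeAt θ (suc d) xor homeAt θ d ≡ not (d ≡ᵇ θ)
homeAt-suc-xor θ d with <-cmp d θ
... | tri< d<θ _ _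
  rewrite homeAt-≤ {θ} d<θ | homeAt-≤ {θ} (<⇒≤ d<θ) | oddB-suc d | not-involutive (oddB d)
        | ≡ᵇ-false (<⇒≢ d<θ) = xor-inverseʳ (oddB d)
... | tri≈ _ refl _
  rewrite homeAt-> {θ} (n<1+n θ) | homeAt-≤ {θ} ≤-refl | oddB-suc θ | ≡ᵇ-refl θ = xor-same (not (oddB θ))
... | tri> _ _ θ<d
  rewrite homeAt-> {θ} (m<n⇒m<1+n θ<d) | homeAt-> {θ} θ<d | oddB-suc d
        | ≡ᵇ-false (≢-sym (<⇒≢ θ<d)) = xor-inverseˡ (oddB d)

homeAt-wrap-xor : ∀ θ m → θ ≤ m + m → homeAt θ 0 xor homeAt θ (m + m) ≡ not ((m + m) ≡ᵇ θ)
homeAt-wrap-xor θ m θ≤2m with m≤n⇒m<n∨m≡n θ≤2m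
... | inj₁ θ<2m rewrite homeAt-> θ<2m | oddB-double m | ≡ᵇ-false (≢-sym (<⇒≢ θ<2m)) = refl
... | inj₂ refl rewrite homeAt-≤ {m + m} ≤-refl | oddB-double m | ≡ᵇ-refl (m + m) = refl

venueOf : Bool → Venue
venueOf true = H
venueOf false = A

venueOf-=V : ∀ b c → (venueOf b =V venueOf c) ≡ not (b xor c)
venueOf-=V true true = refl
venueOf-=V true false = refl
venueOf-=V false true = refl
venueOf-=V false false = refl

team : ℕ → Bool → ℕ
team a e = suc (double+ a e)

team-surjective : ∀ {u} → 1 ≤ u → ∃₂ λ a e → u ≡ team a e
team-surjective {suc u} _ with double+-surjective u
... | a , e , refl = a , e , refl

team-< : ∀ {a b} e f → a < b → team a e < team b f
team-< {a} {b} e f a<b = s≤s (≤-trans (s≤s (double+-≤ a e)) (≤-trans (double-< a<b) (double+-≥ b f)))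

team-not-≢ : ∀ a e → team a (not e) ≢ team a e
team-not-≢ a false = 1+n≢n
team-not-≢ a true = 1+n≢n ∘ sym

oddB-team : ∀ a e → oddB (team a e) ≡ not e
oddB-team a e = trans (oddB-suc (double+ a e)) (cong not (oddB-double+ a e))

sameParity-team : ∀ a b e f → sameParity (team a e) (team b f) ≡ not (e xor f)
sameParity-team a b e f rewrite oddB-team a e | oddB-team b f with e
... | false = refl
... | true = refl

homeAgainst-< : ∀ {a b} e f → team a e < team b f → homeAgainst (team a e) (team b f) ≡ e xor f
homeAgainst-< {a} {b} e f t<u =
  trans (if-false (<ᵇ-false (<⇒≤ t<u))) (trans (cong not (sameParity-team a b e f)) (not-involutive (e xor f)))

homeAgainst-> : ∀ {a b} e f → team b f < team a e → homeAgainst (team a e) (team b f) ≡ not (e xor f)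
homeAgainst-> {a} {b} e f u<t = trans (if-true (<ᵇ-true u<t)) (sameParity-team a b e f)

-- Clause (4) reduces every game to one played by the odd team 2a + 1 of the lower pair.
S-team : ∀ m a b e f → S m (team a e) (team b f) ≡ Sodd m (suc (a + a)) (team b (e xor f))
S-team m a b false f rewrite oddB-team a false = refl
S-team m a b true false rewrite oddB-team a true | oddB-team b false = cong (Sodd m (suc (a + a))) (+-comm (team b false) 1)
S-team m a b true true rewrite oddB-team a true | oddB-team b true = refl

round-< : ∀ {m t u} → t < u → round m t u ≡ S m t u
round-< = if-true ∘ <ᵇ-true

round-> : ∀ {m t u} → u < t → round m t u ≡ S m u t
round-> = if-false ∘ <ᵇ-false ∘ <⇒≤

round-comm : ∀ m t u → round m t u ≡ round m u t
round-comm m t u with <-cmp t u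
... | tri< t<u _ _ = trans (round-< t<u) (sym (round-> t<u))
... | tri≈ _ refl _ = refl
... | tri> _ _ u<t = trans (round-> u<t) (sym (round-< u<t))

hosts : ℕ → ℕ → ℕ → ℕ → Bool
hosts m t r u = not (u ≡ᵇ t) ∧ (round m t u ≡ᵇ r) ∧ homeAgainst t u

hosts-self : ∀ m t r → hosts m t r t ≡ false
hosts-self m t r = cong (λ b → not b ∧ ((round m t t ≡ᵇ r) ∧ homeAgainst t t)) (≡ᵇ-refl t)

hosts-≢ : ∀ {m t r u} → u ≢ t → hosts m t r u ≡ (round m t u ≡ᵇ r) ∧ homeAgainst t u
hosts-≢ {m} {t} {r} {u} u≢t = cong (λ b → not b ∧ ((round m t u ≡ᵇ r) ∧ homeAgainst t u)) (≡ᵇ-false u≢t)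

round-team : ∀ {m a b} e f → team a e < team b f →
             round m (team a e) (team b f) ≡ Sodd m (suc (a + a)) (team b (e xor f))
round-team {m} {a} {b} e f t<u = trans (round-< t<u) (S-team m a b e f)

module Schedule (p : ℕ) where

  K : ℕ
  K = suc (p + p)

  N : ℕ
  N = suc (K + K)

  n : ℕ
  n = suc N

  -- Adding N to the n + 1 of π turns its integer subtraction into a natural one (π≡reflect).
  open Reflection N (n + 1 + N)

  -- Pairs a ≤ p have 2(2a + 1) ≤ n (clause (1) of the table), pairs p < a ≤ K do not
  -- (clauses (2) and (3)); the suffixes -lo and -hi refer to these two halves.
  p<K : p < K
  p<K = s≤s (m≤m+n p p)

  ≤p⇒<K : ∀ {a} → a ≤ p → a < K
  ≤p⇒<K a≤p = ≤-<-trans a≤p p<K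

  ≤T : ∀ {x y} → x ≤ n → y ≤ N → x + y ≤ n + 1 + N
  ≤T x≤n y≤N = ≤-trans (+-mono-≤ x≤n y≤N) (+-monoˡ-≤ N (m≤m+n n 1))

  1+p+c<K : ∀ {c} → c < p → suc (p + c) < K
  1+p+c<K {c} c<p = s≤s (≤-trans (≤-reflexive (sym (+-suc p c))) (+-monoʳ-≤ p c<p))

  K+K≤n : K + K ≤ n
  K+K≤n = ≤-trans (n≤1+n (K + K)) (n≤1+n N)

  ≤p⇒2i≤n : ∀ {a} → a ≤ p → 2 * suc (a + a) ≤ n
  ≤p⇒2i≤n {a} a≤p =
    ≤-trans (*-monoʳ-≤ 2 (s≤s (+-mono-≤ a≤p a≤p))) (≤-trans (m≤m+n (2 * K) 2) (≤-reflexive (2K+2≡n K)))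
    where
    2K+2≡n : ∀ K → 2 * K + 2 ≡ suc (suc (K + K))
    2K+2≡n = solve-∀

  >p⇒n<2i : ∀ {a} → p < a → n < 2 * suc (a + a)
  >p⇒n<2i {a} p<a = ≤-trans (≤-trans (n≤1+n (suc n)) (≤-reflexive (n+2≡2[K+2] K))) (*-monoʳ-≤ 2 (s≤s (double-< p<a)))
    where
    n+2≡2[K+2] : ∀ K → suc (suc (suc (suc (K + K)))) ≡ 2 * suc (suc K)
    n+2≡2[K+2] = solve-∀

  π≡reflect : ∀ {i j} → i ≤ N → j ≤ n → π n i j ≡ suc (reflect (i + j))
  π≡reflect {i} {j} i≤N j≤n = cong suc (begin
    ((ℤ.+ (n + 1) ℤ.- ℤ.+ i) ℤ.- ℤ.+ j) %ℕ N  ≡⟨ cong (_%ℕ N) ([a-i]-j≡a⊖[i+j] (n + 1) i j) ⟩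
    ((n + 1) ⊖ (i + j)) %ℕ N                   ≡⟨ ⊖-%ℕ (n + 1) (i + j) N i+j<T ⟩
    reflect (i + j)                            ∎)
    where
    open ≡-Reasoning
    1+N+n≡T : ∀ N → suc (N + suc N) ≡ suc N + 1 + N
    1+N+n≡T = solve-∀
    i+j<T : i + j < n + 1 + N
    i+j<T = ≤-trans (s≤s (+-mono-≤ i≤N j≤n)) (≤-reflexive (1+N+n≡T N))

  Sodd-π : ∀ {i j} → i < N → j < n → j ≢ i + 1 → Sodd n i j ≡ π n i j
  Sodd-π {i} i<N j<n j≢i+1 with 2 * i ≤? n
  ... | yes 2i≤n = trans (if-false (≡ᵇ-false (<⇒≢ i<N)))
                   (trans (if-true (≤ᵇ-true 2i≤n)) (if-true (<ᵇ-true j<n)))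
  ... | no 2i≰n = trans (if-false (≡ᵇ-false (<⇒≢ i<N)))
                  (trans (if-false (≤ᵇ-false (≰⇒> 2i≰n)))
                  (trans (if-false (≡ᵇ-false j≢i+1)) (if-false (≡ᵇ-false (<⇒≢ j<n)))))

  Sodd-last-lo : ∀ {i} → i < N → 2 * i ≤ n → Sodd n i n ≡ π n i i
  Sodd-last-lo i<N 2i≤n = trans (if-false (≡ᵇ-false (<⇒≢ i<N)))
                          (trans (if-true (≤ᵇ-true 2i≤n)) (if-false (<ᵇ-false {n} {n} ≤-refl)))

  Sodd-last-hi : ∀ {i} → i < N → n < 2 * i → Sodd n i n ≡ π n i (suc i)
  Sodd-last-hi {i} i<N n<2i = trans (if-false (≡ᵇ-false (<⇒≢ i<N)))
                              (trans (if-false (≤ᵇ-false n<2i))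
                              (trans (if-false (≡ᵇ-false (≢-sym (<⇒≢ i+1<n))))
                              (trans (if-true (≡ᵇ-refl n)) (cong (π n i) (+-comm i 1)))))
    where
    i+1<n : i + 1 < n
    i+1<n = subst (_< n) (+-comm 1 i) (s≤s i<N)

  Sodd-next-lo : ∀ {i} → i < N → 2 * i ≤ n → Sodd n i (suc i) ≡ π n i (suc i)
  Sodd-next-lo i<N 2i≤n = trans (if-false (≡ᵇ-false (<⇒≢ i<N)))
                          (trans (if-true (≤ᵇ-true 2i≤n)) (if-true (<ᵇ-true (s≤s i<N))))

  Sodd-next-hi : ∀ {i} → i < N → n < 2 * i → Sodd n i (suc i) ≡ π n i i
  Sodd-next-hi {i} i<N n<2i = trans (if-false (≡ᵇ-false (<⇒≢ i<N)))
                              (trans (if-false (≤ᵇ-false n<2i)) (if-true (≡ᵇ-true (+-comm 1 i))))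

  Sodd-N : ∀ j → Sodd n N j ≡ 3
  Sodd-N j = if-true (≡ᵇ-refl N)

  roundAt : ℕ → ℕ → ℕ
  roundAt a δ = suc (reflect (suc (a + a) + suc δ))

  offsetOf : ℕ → ℕ → ℕ
  offsetOf a r = reflect (suc (a + a) + r)

  i≤N : ∀ {a} → a ≤ K → suc (a + a) ≤ N
  i≤N a≤K = s≤s (+-mono-≤ a≤K a≤K)

  i<N : ∀ {a} → a < K → suc (a + a) < N
  i<N a<K = s≤s (+-mono-< a<K a<K)

  double+<N : ∀ {x} g → x < K → double+ x g < N
  double+<N {x} g x<K = ≤-<-trans (double+-≤ x g) (i<N x<K)

  team≤n : ∀ {b} g → b ≤ K → team b g ≤ n
  team≤n {b} g b≤K = s≤s (≤-trans (double+-≤ b g) (i≤N b≤K))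

  team<n⇒≤K : ∀ {b g} → team b g < n → b ≤ K
  team<n⇒≤K {b} {g} t<n = double-cancel-≤ (≤-trans (double+-≥ b g) (≤-pred (≤-pred t<n)))

  team≤n⇒≤K : ∀ {b g} → team b g ≤ n → b ≤ K
  team≤n⇒≤K {b} {g} t≤n with b ≤? K
  ... | yes b≤K = b≤K
  ... | no b≰K = contradiction t≤n (<⇒≱ (team-< true g (≰⇒> b≰K)))

  team<n⊎last : ∀ {b} g → b ≤ K → team b g < n ⊎ (b ≡ K × g ≡ true)
  team<n⊎last {b} false b≤K = inj₁ (s≤s (i≤N b≤K))
  team<n⊎last {b} true b≤K with m≤n⇒m<n∨m≡n b≤K
  ... | inj₁ b<K = inj₁ (s≤s (s≤s (+-mono-< b<K b<K)))
  ... | inj₂ b≡K = inj₂ (b≡K , refl)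

  reflect-N+N : reflect (N + N) ≡ 2
  reflect-N+N = trans (cong (λ t → (t ∸ (N + N)) % N) (T≡ N)) (trans (cong (_% N) (m+n∸n≡m 2 (N + N))) (m<n⇒m%n≡m 2<N))
    where
    T≡ : ∀ N → suc N + 1 + N ≡ 2 + (N + N)
    T≡ = solve-∀
    2<N : 2 < N
    2<N = s≤s (+-mono-≤ {1} {K} (s≤s z≤n) (s≤s z≤n))

  offsetOf<N : ∀ a r → offsetOf a r < N
  offsetOf<N a r = m%n<n (n + 1 + N ∸ (suc (a + a) + r)) N

  offsetOf-roundAt : ∀ {a δ} → a ≤ K → δ < N → offsetOf a (roundAt a δ) ≡ δ
  offsetOf-roundAt {a} {δ} a≤K δ<N = begin
    reflect (i + suc (reflect (i + suc δ)))   ≡⟨ cong reflect (+-suc i _) ⟩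
    reflect (suc i + reflect (i + suc δ))     ≡⟨ cong (λ x → reflect (suc i + reflect x)) (+-suc i δ) ⟩
    reflect (suc i + reflect (suc i + δ))     ≡⟨ reflect-involutive (suc i) δ (≤T (s≤s (i≤N a≤K)) (<⇒≤ δ<N)) ⟩
    δ % N                                     ≡⟨ m<n⇒m%n≡m δ<N ⟩
    δ                                         ∎
    where
    open ≡-Reasoning
    i = suc (a + a)

  roundAt-offsetOf : ∀ {a r} → a ≤ K → r < N → roundAt a (offsetOf a (suc r)) ≡ suc r
  roundAt-offsetOf a≤K r<N = cong suc (offsetOf-roundAt a≤K r<N)

  offsetOf-N : ∀ {a} → a ≤ K → offsetOf a N ≡ suc (offsetOf a 1) % N
  offsetOf-N {a} a≤K = begin
    reflect (i + N)              ≡⟨ reflect-+N i (≤T (≤-trans (i≤N a≤K) (n≤1+n N)) ≤-refl) ⟩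
    reflect i                    ≡⟨ reflect-suc i (≤-trans (m≤m+n (suc i) N) (≤T (s≤s (i≤N a≤K)) ≤-refl)) ⟩
    suc (reflect (suc i)) % N    ≡⟨ cong (λ x → suc (reflect x) % N) (+-comm 1 i) ⟩
    suc (reflect (i + 1)) % N    ∎
    where
    open ≡-Reasoning
    i = suc (a + a)

  offsetOf-suc : ∀ {a r} → a ≤ K → suc r < N → offsetOf a (suc r) ≡ suc (offsetOf a (suc (suc r))) % N
  offsetOf-suc {a} {r} a≤K 2+r<N =
    trans (reflect-suc (i + suc r) (≤T (s≤s (i≤N a≤K)) (<⇒≤ 2+r<N)))
          (cong (λ x → suc (reflect x) % N) (sym (+-suc i (suc r))))
    where
    i = suc (a + a)

  round-above : ∀ {a b} e f → a < b → team b (e xor f) < n →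
                round n (team a e) (team b f) ≡ roundAt a (double+ b (e xor f))
  round-above {a} {b} e f a<b j<n = begin
    round n (team a e) (team b f)              ≡⟨ round-team e f (team-< e f a<b) ⟩
    Sodd n (suc (a + a)) (team b (e xor f))    ≡⟨ Sodd-π (i<N a<K) j<n (≢-sym (<⇒≢ i+1<j)) ⟩
    π n (suc (a + a)) (team b (e xor f))       ≡⟨ π≡reflect (<⇒≤ (i<N a<K)) (<⇒≤ j<n) ⟩
    roundAt a (double+ b (e xor f))            ∎
    where
    open ≡-Reasoning
    a<K : a < K
    a<K = <-≤-trans a<b (team<n⇒≤K {g = e xor f} j<n)
    i+1<j : suc (a + a) + 1 < team b (e xor f)
    i+1<j = subst (_< team b (e xor f)) (+-comm 1 (suc (a + a))) (team-< true (e xor f) a<b)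

  π-self : ∀ {a} → a ≤ K → π n (suc (a + a)) (suc (a + a)) ≡ roundAt a (double+ a false)
  π-self a≤K = π≡reflect (i≤N a≤K) (≤-trans (i≤N a≤K) (n≤1+n N))

  π-next : ∀ {a} → a < K → π n (suc (a + a)) (suc (suc (a + a))) ≡ roundAt a (double+ a true)
  π-next a<K = π≡reflect (<⇒≤ (i<N a<K)) (m≤n⇒m≤1+n (i<N a<K))

  round-last : ∀ {a} e → a < K → round n (team a e) (team K (not e)) ≡ Sodd n (suc (a + a)) n
  round-last {a} e a<K =
    trans (round-team e (not e) (team-< e (not e) a<K)) (cong (Sodd n (suc (a + a)) ∘ team K) (xor-inverseʳ e))

  round-last-lo : ∀ {a} e → a ≤ p → round n (team a e) (team K (not e)) ≡ roundAt a (double+ a false)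
  round-last-lo e a≤p = trans (round-last e a<K) (trans (Sodd-last-lo (i<N a<K) (≤p⇒2i≤n a≤p)) (π-self (<⇒≤ a<K)))
    where a<K = ≤p⇒<K a≤p

  round-last-hi : ∀ {a} e → p < a → a < K → round n (team a e) (team K (not e)) ≡ roundAt a (double+ a true)
  round-last-hi e p<a a<K = trans (round-last e a<K) (trans (Sodd-last-hi (i<N a<K) (>p⇒n<2i p<a)) (π-next a<K))

  round-partner : ∀ a → round n (team a false) (team a true) ≡ Sodd n (suc (a + a)) (suc (suc (a + a)))
  round-partner a = round-team {a = a} {b = a} false true ≤-refl

  round-partner-lo : ∀ {a} → a ≤ p → round n (team a false) (team a true) ≡ roundAt a (double+ a true)
  round-partner-lo {a} a≤p = trans (round-partner a) (trans (Sodd-next-lo (i<N a<K) (≤p⇒2i≤n a≤p)) (π-next a<K))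
    where a<K = ≤p⇒<K a≤p

  round-partner-hi : ∀ {a} → p < a → a ≤ K → round n (team a false) (team a true) ≡ roundAt a (double+ a false)
  round-partner-hi {a} p<a a≤K with m≤n⇒m<n∨m≡n a≤K
  ... | inj₁ a<K = trans (round-partner a) (trans (Sodd-next-hi (i<N a<K) (>p⇒n<2i p<a)) (π-self a≤K))
  ... | inj₂ refl = trans (round-partner K) (trans (Sodd-N n) (cong suc (sym reflect-N+N)))

  breakOffset : ℕ → Bool → ℕ
  breakOffset a false = a + a
  breakOffset a true = if a ≤ᵇ p then suc (a + a) else pred (a + a)

  breakOffset-lo : ∀ {a} → a ≤ p → breakOffset a true ≡ suc (a + a)
  breakOffset-lo = if-true ∘ ≤ᵇ-true

  breakOffset-hi : ∀ {a} → p < a → breakOffset a true ≡ pred (a + a)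
  breakOffset-hi = if-false ∘ ≤ᵇ-false

  breakOffset≤ : ∀ a e → breakOffset a e ≤ suc (a + a)
  breakOffset≤ a false = n≤1+n (a + a)
  breakOffset≤ a true with a ≤? p
  ... | yes a≤p = ≤-reflexive (breakOffset-lo a≤p)
  ... | no a≰p = ≤-trans (≤-reflexive (breakOffset-hi (≰⇒> a≰p))) (≤-trans pred[n]≤n (n≤1+n (a + a)))

  breakOffset≥ : ∀ {a b} e → b < a → suc (b + b) ≤ breakOffset a e
  breakOffset≥ false b<a = ≤-trans (n≤1+n _) (double-< b<a)
  breakOffset≥ {a} true b<a with a ≤? p
  ... | yes a≤p = ≤-trans (s≤s (+-mono-≤ (<⇒≤ b<a) (<⇒≤ b<a))) (≤-reflexive (sym (breakOffset-lo a≤p)))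
  ... | no a≰p = ≤-trans (pred-mono-≤ (double-< b<a)) (≤-reflexive (sym (breakOffset-hi (≰⇒> a≰p))))

  breakOffset<N : ∀ {a} e → a ≤ K → breakOffset a e < N
  breakOffset<N {a} false a≤K = i≤N a≤K
  breakOffset<N {a} true a≤K with a ≤? p
  ... | yes a≤p = subst (_< N) (sym (breakOffset-lo a≤p)) (i<N (≤p⇒<K a≤p))
  ... | no a≰p = subst (_< N) (sym (breakOffset-hi (≰⇒> a≰p))) (≤-trans (s≤s pred[n]≤n) (i≤N a≤K))

  double≤breakOffset : ∀ {a} e → a ≤ p → a + a ≤ breakOffset a e
  double≤breakOffset false a≤p = ≤-refl
  double≤breakOffset true a≤p = ≤-trans (n≤1+n _) (≤-reflexive (sym (breakOffset-lo a≤p)))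

  breakOffset<double+1 : ∀ {a} e → p < a → breakOffset a e < suc (a + a)
  breakOffset<double+1 false p<a = ≤-refl
  breakOffset<double+1 true p<a = s≤s (≤-trans (≤-reflexive (breakOffset-hi p<a)) pred[n]≤n)

  pred-double< : ∀ {a} → p < a → pred (a + a) < a + a
  pred-double< {suc a} _ = ≤-refl

  breakOffset-last≥ : ∀ {x} e → x ≤ p + p → suc (x + x) ≤ breakOffset K e
  breakOffset-last≥ {x} e x≤2p = ≤-trans (s≤s (+-mono-≤ x≤2p x≤2p)) (bound e)
    where
    bound : ∀ e → suc ((p + p) + (p + p)) ≤ breakOffset K e
    bound false = ≤-trans (≤-reflexive (sym (+-suc (p + p) (p + p)))) (n≤1+n _)
    bound true = ≤-trans (≤-reflexive (sym (+-suc (p + p) (p + p)))) (≤-reflexive (sym (breakOffset-hi p<K)))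

  -- Team (a, e) meets u at offset δ. The offsets of its opponents are exactly 0, …, N - 1
  -- (fixture-of-opponent, opponent-at-offset).
  Fixture : ℕ → Bool → ℕ → ℕ → Set
  Fixture a e u δ = round n (team a e) u ≡ roundAt a δ
                  × homeAgainst (team a e) u ≡ homeAt (breakOffset a e) δ

  roundAt-swap : ∀ a b g → roundAt b (double+ a g) ≡ roundAt a (double+ b g)
  roundAt-swap a b false = cong (suc ∘ reflect) (swap a b)
    where
    swap : ∀ a b → suc (b + b) + suc (a + a) ≡ suc (a + a) + suc (b + b)
    swap = solve-∀
  roundAt-swap a b true = cong (suc ∘ reflect) (swap a b)
    where
    swap : ∀ a b → suc (b + b) + suc (suc (a + a)) ≡ suc (a + a) + suc (suc (b + b))
    swap = solve-∀

  fixture-above : ∀ {a b} e f {g} → a < b → e xor f ≡ g → team b g < n → Fixture a e (team b f) (double+ b g)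
  fixture-above {a} {b} e f a<b refl j<n =
    round-above e f a<b j<n ,
    trans (homeAgainst-< e f (team-< e f a<b)) (sym (trans (homeAt-> θ<δ) (oddB-double+ b (e xor f))))
    where
    θ<δ : breakOffset a e < double+ b (e xor f)
    θ<δ = ≤-trans (s≤s (breakOffset≤ a e)) (≤-trans (double-< a<b) (double+-≥ b (e xor f)))

  fixture-below : ∀ {a b} e f {g} → b < a → e xor f ≡ g → team a g < n → Fixture a e (team b f) (double+ b g)
  fixture-below {a} {b} e f b<a refl j<n =
    (begin
      round n (team a e) (team b f)    ≡⟨ round-comm n (team a e) (team b f) ⟩
      round n (team b f) (team a e)    ≡⟨ round-above f e b<a (subst (λ g → team a g < n) (xor-comm e f) j<n) ⟩
      roundAt b (double+ a (f xor e))  ≡⟨ cong (roundAt b ∘ double+ a) (xor-comm f e) ⟩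
      roundAt b (double+ a (e xor f))  ≡⟨ roundAt-swap a b (e xor f) ⟩
      roundAt a (double+ b (e xor f))  ∎) ,
    trans (homeAgainst-> e f (team-< f e b<a)) (sym (trans (homeAt-≤ δ≤θ) (cong not (oddB-double+ b (e xor f)))))
    where
    open ≡-Reasoning
    δ≤θ : double+ b (e xor f) ≤ breakOffset a e
    δ≤θ = ≤-trans (double+-≤ b (e xor f)) (breakOffset≥ e b<a)

  fixture-last-lo : ∀ {a} e → a ≤ p → Fixture a e (team K (not e)) (double+ a false)
  fixture-last-lo {a} e a≤p =
    round-last-lo e a≤p ,
    trans (homeAgainst-< e (not e) (team-< e (not e) (≤p⇒<K a≤p)))
      (trans (xor-inverseʳ e) (sym (trans (homeAt-≤ (double≤breakOffset e a≤p)) (cong not (oddB-double a)))))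

  fixture-last-hi : ∀ {a} e → p < a → a < K → Fixture a e (team K (not e)) (double+ a true)
  fixture-last-hi {a} e p<a a<K =
    round-last-hi e p<a a<K ,
    trans (homeAgainst-< e (not e) (team-< e (not e) a<K))
      (trans (xor-inverseʳ e) (sym (trans (homeAt-> (breakOffset<double+1 e p<a)) (oddB-double+ a true))))

  fixture-partner-lo : ∀ {a} e → a ≤ p → Fixture a e (team a (not e)) (double+ a true)
  fixture-partner-lo {a} false a≤p =
    round-partner-lo a≤p ,
    trans (homeAgainst-< {a} {a} false true ≤-refl) (sym (trans (homeAt-> {a + a} ≤-refl) (oddB-double+ a true)))
  fixture-partner-lo {a} true a≤p =
    trans (round-comm n (team a true) (team a false)) (round-partner-lo a≤p) ,
    trans (homeAgainst-> {a} {a} true false ≤-refl)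
      (sym (trans (homeAt-≤ (≤-reflexive (sym (breakOffset-lo a≤p)))) (cong not (oddB-double+ a true))))

  fixture-partner-hi : ∀ {a} e → p < a → a ≤ K → Fixture a e (team a (not e)) (double+ a false)
  fixture-partner-hi {a} false p<a a≤K =
    round-partner-hi p<a a≤K ,
    trans (homeAgainst-< {a} {a} false true ≤-refl) (sym (trans (homeAt-≤ {a + a} ≤-refl) (cong not (oddB-double a))))
  fixture-partner-hi {a} true p<a a≤K =
    trans (round-comm n (team a true) (team a false)) (round-partner-hi p<a a≤K) ,
    trans (homeAgainst-> {a} {a} true false ≤-refl)
      (sym (trans (homeAt-> (subst (_< a + a) (sym (breakOffset-hi p<a)) (pred-double< p<a))) (oddB-double a)))

  -- The last pair meets the opposite-parity teams of pair b ≤ p at offset 4b + 1 and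
  -- those of pair p + 1 + c at offset 4c + 3.
  round-from-last : ∀ b e → round n (team K e) (team b (not e)) ≡ round n (team b (not e)) (team K (not (not e)))
  round-from-last b e =
    trans (round-comm n (team K e) (team b (not e))) (cong (round n (team b (not e)) ∘ team K) (sym (not-involutive e)))

  home-from-last : ∀ {b x} e → b < K → x ≤ p + p →
                   homeAgainst (team K e) (team b (not e)) ≡ homeAt (breakOffset K e) (double+ x true)
  home-from-last {b} {x} e b<K x≤2p =
    trans (homeAgainst-> e (not e) (team-< (not e) e b<K))
      (trans (cong not (xor-inverseʳ e))
        (sym (trans (homeAt-≤ (breakOffset-last≥ e x≤2p)) (cong not (oddB-double+ x true)))))

  fixture-from-last-lo : ∀ {b} e → b ≤ p → Fixture K e (team b (not e)) (double+ (b + b) true)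
  fixture-from-last-lo {b} e b≤p =
    (begin
      round n (team K e) (team b (not e))              ≡⟨ round-from-last b e ⟩
      round n (team b (not e)) (team K (not (not e)))  ≡⟨ round-last-lo (not e) b≤p ⟩
      suc (reflect (suc (b + b) + suc (b + b)))        ≡⟨ cong suc (reflect-+N (suc (b + b) + suc (b + b)) bound) ⟨
      suc (reflect (suc (b + b) + suc (b + b) + N))    ≡⟨ cong (suc ∘ reflect) (regroup K b) ⟩
      roundAt K (double+ (b + b) true)                 ∎) ,
    home-from-last e (≤p⇒<K b≤p) (+-mono-≤ b≤p b≤p)
    where
    open ≡-Reasoning
    regroup : ∀ K b → suc (b + b) + suc (b + b) + suc (K + K) ≡ suc (K + K) + suc (suc ((b + b) + (b + b)))
    regroup = solve-∀
    bound : suc (b + b) + suc (b + b) + N ≤ n + 1 + N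
    bound = ≤T (≤-trans (+-mono-≤ (s≤s (+-mono-≤ b≤p b≤p)) (s≤s (+-mono-≤ b≤p b≤p))) K+K≤n) ≤-refl

  fixture-from-last-hi : ∀ {c} e → c < p → Fixture K e (team (suc (p + c)) (not e)) (double+ (suc (c + c)) true)
  fixture-from-last-hi {c} e c<p =
    (begin
      round n (team K e) (team b (not e))              ≡⟨ round-from-last b e ⟩
      round n (team b (not e)) (team K (not (not e)))  ≡⟨ round-last-hi (not e) (s≤s (m≤m+n p c)) b<K ⟩
      roundAt b (double+ b true)                       ≡⟨ cong (suc ∘ reflect) (regroup p c) ⟩
      roundAt K (double+ (suc (c + c)) true)           ∎) ,
    home-from-last e b<K (+-mono-≤ c<p (<⇒≤ c<p))
    where
    open ≡-Reasoning
    b = suc (p + c)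
    b<K = 1+p+c<K c<p
    regroup : ∀ p c → suc (suc (p + c) + suc (p + c)) + suc (suc (suc (p + c) + suc (p + c)))
                    ≡ suc (suc (p + p) + suc (p + p)) + suc (suc (suc (c + c) + suc (c + c)))
    regroup = solve-∀

  fixture-of-opponent : ∀ {a b} e f → a ≤ K → b ≤ K → team b f ≢ team a e →
                        ∃ λ δ → δ < N × Fixture a e (team b f) δ
  fixture-of-opponent {a} {b} e f a≤K b≤K u≢t with <-cmp a b
  ... | tri< a<b _ _ with team<n⊎last (e xor f) b≤K
  ...   | inj₁ j<n = _ , ≤-pred j<n , fixture-above e f a<b refl j<n
  ...   | inj₂ (refl , e⊕f≡true) with refl ← xor≡true⇒≡not e f e⊕f≡true with a ≤? p
  ...     | yes a≤p = _ , double+<N false a<b , fixture-last-lo e a≤p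
  ...     | no a≰p = _ , double+<N true a<b , fixture-last-hi e (≰⇒> a≰p) a<b
  fixture-of-opponent {a} e f a≤K _ u≢t | tri≈ _ refl _ with ≡⊎≡not e f
  ... | inj₁ refl = contradiction refl u≢t
  ... | inj₂ refl with a ≤? p
  ...   | yes a≤p = _ , double+<N true (≤p⇒<K a≤p) , fixture-partner-lo e a≤p
  ...   | no a≰p = _ , i≤N a≤K , fixture-partner-hi e (≰⇒> a≰p) a≤K
  fixture-of-opponent {a} {b} e f a≤K b≤K u≢t | tri> _ _ b<a with team<n⊎last (e xor f) a≤K
  ... | inj₁ j<n = _ , double+<N (e xor f) (<-≤-trans b<a a≤K) , fixture-below e f b<a refl j<n
  ... | inj₂ (refl , e⊕f≡true) with refl ← xor≡true⇒≡not e f e⊕f≡true with b ≤? p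
  ...   | yes b≤p = _ , double+<N true (≤-<-trans (+-mono-≤ b≤p b≤p) (n<1+n (p + p))) , fixture-from-last-lo e b≤p
  ...   | no b≰p with c , refl ← m≤n⇒∃[o]m+o≡n (≰⇒> b≰p) =
    _ , double+<N true (s≤s (+-mono-< c<p c<p)) , fixture-from-last-hi e c<p
    where
    c<p : c < p
    c<p = +-cancelˡ-< p c p (≤-pred b<a)

  opponent-at-offset : ∀ {a} e δ → a ≤ K → δ < N →
                       ∃₂ λ b f → b ≤ K × team b f ≢ team a e × Fixture a e (team b f) δ
  opponent-at-offset {a} e δ a≤K δ<N with double+-surjective δ
  ... | b , g , refl with <-cmp b a
  ...   | tri< b<a _ _ with team<n⊎last g a≤K
  ...     | inj₁ j<n =
    b , e xor g , <⇒≤ (<-≤-trans b<a a≤K) , <⇒≢ (team-< (e xor g) e b<a) ,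
    fixture-below e (e xor g) b<a (xor-cancelˡ e g) j<n
  ...     | inj₂ (refl , refl) with double+-surjective b
  ...       | c , false , refl =
    c , not e , <⇒≤ (≤p⇒<K c≤p) , <⇒≢ (team-< (not e) e (≤p⇒<K c≤p)) , fixture-from-last-lo e c≤p
    where
    c≤p : c ≤ p
    c≤p = double-cancel-≤ (≤-pred b<a)
  ...       | c , true , refl =
    suc (p + c) , not e , <⇒≤ b<K , <⇒≢ (team-< (not e) e b<K) , fixture-from-last-hi e c<p
    where
    c<p : c < p
    c<p = double-cancel-< (≤-pred b<a)
    b<K = 1+p+c<K c<p
  opponent-at-offset {a} e _ a≤K δ<N | a , false , refl | tri≈ _ refl _ with a ≤? p
  ... | yes a≤p = K , not e , ≤-refl , ≢-sym (<⇒≢ (team-< e (not e) (≤p⇒<K a≤p))) , fixture-last-lo e a≤p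
  ... | no a≰p = a , not e , a≤K , team-not-≢ a e , fixture-partner-hi e (≰⇒> a≰p) a≤K
  opponent-at-offset {a} e _ a≤K δ<N | a , true , refl | tri≈ _ refl _ with a ≤? p
  ... | yes a≤p = a , not e , a≤K , team-not-≢ a e , fixture-partner-lo e a≤p
  ... | no a≰p = K , not e , ≤-refl , ≢-sym (<⇒≢ (team-< e (not e) a<K)) , fixture-last-hi e (≰⇒> a≰p) a<K
    where
    a<K : a < K
    a<K = double-cancel-< (≤-pred δ<N)
  opponent-at-offset {a} e _ a≤K δ<N | b , g , refl | tri> _ _ a<b =
    b , e xor g , team<n⇒≤K {g = g} (s≤s δ<N) , ≢-sym (<⇒≢ (team-< e (e xor g) a<b)) ,
    fixture-above e (e xor g) a<b (xor-cancelˡ e g) (s≤s δ<N)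

  venue-team : ∀ {a} e r → a ≤ K → r < N →
               venue n (team a e) (suc r) ≡ venueOf (homeAt (breakOffset a e) (offsetOf a (suc r)))
  venue-team {a} e r a≤K r<N with homeAt (breakOffset a e) (offsetOf a (suc r)) in home≡
  ... | true
    with b , f , b≤K , u≢t , round≡ , home≡′ ← opponent-at-offset e (offsetOf a (suc r)) a≤K (offsetOf<N a (suc r)) =
    if-true (any-true (hosts n (team a e) (suc r)) (∈-teams⁺ (team≤n f b≤K)) hosts≡true)
    where
    hosts≡true : hosts n (team a e) (suc r) (team b f) ≡ true
    hosts≡true = trans (hosts-≢ u≢t)
      (cong₂ _∧_ (≡ᵇ-true (trans round≡ (roundAt-offsetOf a≤K r<N))) (trans home≡′ home≡))
  ... | false = if-false (any-false (hosts n (team a e) (suc r)) (teams n) hosts≡false)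
    where
    θ = breakOffset a e
    away : ∀ {δ} → δ < N → (roundAt a δ ≡ᵇ suc r) ∧ homeAt θ δ ≡ false
    away {δ} δ<N with roundAt a δ ≟ suc r
    ... | no ≢r = cong (_∧ homeAt θ δ) (≡ᵇ-false ≢r)
    ... | yes ≡r = trans (cong (_∧ homeAt θ δ) (≡ᵇ-true ≡r)) (trans (cong (homeAt θ) δ≡) home≡)
      where
      δ≡ : δ ≡ offsetOf a (suc r)
      δ≡ = trans (sym (offsetOf-roundAt a≤K δ<N)) (cong (offsetOf a) ≡r)
    hosts≡false : ∀ {u} → u ∈ teams n → hosts n (team a e) (suc r) u ≡ false
    hosts≡false u∈ with u′ , refl , u′<n ← ∈-teams⁻ u∈ with b , f , refl ← double+-surjective u′
                  with team b f ≟ team a e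
    ... | yes u≡t = subst (λ u → hosts n (team a e) (suc r) u ≡ false) (sym u≡t) (hosts-self n (team a e) (suc r))
    ... | no u≢t with δ , δ<N , round≡ , home≡′ ← fixture-of-opponent e f a≤K (team≤n⇒≤K {g = f} u′<n) u≢t =
      trans (hosts-≢ u≢t) (trans (cong₂ _∧_ (cong (_≡ᵇ suc r) round≡) home≡′) (away δ<N))

  hap-team : ∀ {a} e r → a ≤ K → r < N →
             hap n (team a e) r ≡ venueOf (homeAt (breakOffset a e) (suc (offsetOf a (suc r)) % N))
  hap-team e zero a≤K _ =
    trans (venue-team e (K + K) a≤K ≤-refl) (cong (venueOf ∘ homeAt (breakOffset _ e)) (offsetOf-N a≤K))
  hap-team e (suc r) a≤K 1+r<N =
    trans (venue-team e r a≤K (<-trans (n<1+n r) 1+r<N)) (cong (venueOf ∘ homeAt (breakOffset _ e)) (offsetOf-suc a≤K 1+r<N))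

  homeAt-step : ∀ {θ d} → θ < N → d < N → homeAt θ (suc d % N) xor homeAt θ d ≡ not (d ≡ᵇ θ)
  homeAt-step {θ} {d} θ<N d<N with m≤n⇒m<n∨m≡n d<N
  ... | inj₁ 1+d<N = trans (cong (λ x → homeAt θ x xor homeAt θ d) (m<n⇒m%n≡m 1+d<N)) (homeAt-suc-xor θ d)
  ... | inj₂ refl = trans (cong (λ x → homeAt θ x xor homeAt θ (K + K)) (n%n≡0 N)) (homeAt-wrap-xor θ K (≤-pred θ<N))

  offsetOf-≡ᵇ : ∀ {a θ r} → a ≤ K → θ < N → r < N → (offsetOf a (suc r) ≡ᵇ θ) ≡ (suc r ≡ᵇ roundAt a θ)
  offsetOf-≡ᵇ {a} {θ} {r} a≤K θ<N r<N with suc r ≟ roundAt a θ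
  ... | yes r≡ = trans (≡ᵇ-true (trans (cong (offsetOf a) r≡) (offsetOf-roundAt a≤K θ<N))) (sym (≡ᵇ-true r≡))
  ... | no r≢ = trans (≡ᵇ-false (r≢ ∘ (trans (sym (roundAt-offsetOf a≤K r<N)) ∘ cong (roundAt a))))
                      (sym (≡ᵇ-false r≢))

  break-at : ∀ {a} e r → a ≤ K → r < N →
             (hap n (team a e) r =V hap n (team a e) (suc r)) ≡ (suc r ≡ᵇ roundAt a (breakOffset a e))
  break-at {a} e r a≤K r<N = begin
    hap n (team a e) r =V hap n (team a e) (suc r)
      ≡⟨ cong₂ _=V_ (hap-team e r a≤K r<N) (venue-team e r a≤K r<N) ⟩
    venueOf (homeAt θ (suc d % N)) =V venueOf (homeAt θ d)
      ≡⟨ venueOf-=V (homeAt θ (suc d % N)) (homeAt θ d) ⟩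
    not (homeAt θ (suc d % N) xor homeAt θ d)
      ≡⟨ cong not (homeAt-step (breakOffset<N e a≤K) (offsetOf<N a (suc r))) ⟩
    not (not (d ≡ᵇ θ))
      ≡⟨ not-involutive (d ≡ᵇ θ) ⟩
    d ≡ᵇ θ
      ≡⟨ offsetOf-≡ᵇ a≤K (breakOffset<N e a≤K) r<N ⟩
    suc r ≡ᵇ roundAt a θ  ∎
    where
    open ≡-Reasoning
    θ = breakOffset a e
    d = offsetOf a (suc r)

  breaks-team : ∀ {a} e → a ≤ K → breaks n (team a e) ≡ 1
  breaks-team {a} e a≤K = begin
    breaks n (team a e)
      ≡⟨ countB-cong (teams N) is-break ⟩
    countB (_≡ᵇ roundAt a (breakOffset a e)) (teams N)
      ≡⟨ countB-≡ᵇ-unique (teams-unique N) (∈-teams⁺ (offsetOf<N a (suc (breakOffset a e)))) ⟩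
    1 ∎
    where
    open ≡-Reasoning
    is-break : ∀ {x} → x ∈ teams N →
               (hap n (team a e) (x ∸ 1) =V hap n (team a e) x) ≡ (x ≡ᵇ roundAt a (breakOffset a e))
    is-break x∈ with r , refl , r<N ← ∈-teams⁻ x∈ = break-at e r a≤K r<N

  single-break : ∀ t → 1 ≤ t → t ≤ n → breaks n t ≡ 1
  single-break t 1≤t t≤n with a , e , refl ← team-surjective 1≤t = breaks-team e (team≤n⇒≤K {g = e} t≤n)

lemma4 : (k : ℕ) → 1 ≤ k → (t : ℕ) → 1 ≤ t → t ≤ 4 * k → breaks (4 * k) t ≡ 1
lemma4 (suc p) _ t 1≤t t≤4k =
  subst (λ m → breaks m t ≡ 1) (sym 4k≡n) (single-break t 1≤t (subst (t ≤_) 4k≡n t≤4k))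
  where
  open Schedule p
  4k≡n : 4 * suc p ≡ n
  4k≡n = 4[1+p]≡4p+4 p
    where
    4[1+p]≡4p+4 : ∀ p → 4 * suc p ≡ suc (suc (suc (p + p) + suc (p + p)))
    4[1+p]≡4p+4 = solve-∀
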